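{- Let $u$ be a recurrent infinite word over a finite alphabet, let $m\in\mathbb N$, and suppose $u$ has no weak bispecial factor and $\Delta C(n)<m$ for all $n\ge 0$. Then $\#\mathcal R(w)\le m$ for every factor $w$ of $u$.
   Context: Let $u=u_0u_1\cdots$ be an infinite word over a finite alphabet $\mathcal A$; $u$ is recurrent if every factor occurs infinitely often. Factors are finite (possibly empty) words occurring in $u$; $C(n)$ is the number of factors of length $n$ and $\Delta C(n)=C(n+1)-C(n)$. For a factor $w$, $\mathcal E_\ell(w)=\{a\in\mathcal A: aw \text{ is a factor}\}$, $\mathcal E_r(w)=\{b\in\mathcal A: wb\text{ is a factor}\}$. If $j<k$ are successive occurrences of $w$ (positions $j$ with $u_j\cdots u_{j+|w|-1}=w$), then $u_j\cdots u_{k-1}$ is a return word of $w$; $\mathcal R(w)$ is the set of return words. The bilateral order of $w$ is $B(w)=\#\{awb \text{ factor of } u: a,b\in\mathcal A\}-\#\mathcal E_\ell(w)-\#\mathcal E_r(w)+1$, and $w$ is weak bispecial if $B(w)<0$. -}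

module Defs where

open import Data.Nat using (ℕ; zero; suc; _+_; _∸_; _≤_; _<_)
open import Data.Fin using (Fin)
open import Data.List using (List; []; _∷_; _++_; length)
open import Data.List.Membership.Propositional using (_∈_)
open import Data.List.Relation.Unary.Unique.Propositional using (Unique)
open import Data.List.Relation.Unary.All using (All)
open import Data.Product using (Σ; ∃; _×_; _,_)
open import Relation.Binary.PropositionalEquality using (_≡_)
open import Relation.Nullary using (¬_)
open import Function.Bundles using (_⇔_)

InfWord : ℕ → Set
InfWord k = ℕ → Fin k

FWord : ℕ → Set
FWord k = List (Fin k)

segment : ∀ {k} → InfWord k → ℕ → ℕ → FWord k
segment u i zero    = []
segment u i (suc n) = u i ∷ segment u (suc i) n

OccursAt : ∀ {k} → InfWord k → FWord k → ℕ → Set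
OccursAt u w i = segment u i (length w) ≡ w

Factor : ∀ {k} → InfWord k → FWord k → Set
Factor u w = ∃ λ i → OccursAt u w i

Recurrent : ∀ {k} → InfWord k → Set
Recurrent u = ∀ w → Factor u w → ∀ N → ∃ λ i → N ≤ i × OccursAt u w i

HasCard : {A : Set} → (A → Set) → ℕ → Set
HasCard {A} P c = Σ (List A) λ L → Unique L × (∀ x → (x ∈ L) ⇔ P x) × length L ≡ c

FactorComplexity : ∀ {k} → InfWord k → ℕ → ℕ → Set
FactorComplexity u n c = HasCard (λ w → Factor u w × length w ≡ n) c

LeftExt : ∀ {k} → InfWord k → FWord k → Fin k → Set
LeftExt u w a = Factor u (a ∷ w)

RightExt : ∀ {k} → InfWord k → FWord k → Fin k → Set
RightExt u w b = Factor u (w ++ (b ∷ []))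

BiExt : ∀ {k} → InfWord k → FWord k → Fin k × Fin k → Set
BiExt u w (a , b) = Factor u (a ∷ (w ++ (b ∷ [])))

-- w is a weak bispecial factor: B(w) = e - el - er + 1 < 0,
-- i.e. e + 1 < el + er.
WeakBispecial : ∀ {k} → InfWord k → FWord k → Set
WeakBispecial u w =
  Factor u w ×
  Σ ℕ λ e → Σ ℕ λ el → Σ ℕ λ er →
    HasCard (BiExt u w) e × HasCard (LeftExt u w) el × HasCard (RightExt u w) er ×
    e + 1 < el + er

ReturnWord : ∀ {k} → InfWord k → FWord k → FWord k → Set
ReturnWord u w v =
  Σ ℕ λ j → Σ ℕ λ k →
    j < k × OccursAt u w j × OccursAt u w k ×
    (∀ l → j < l → l < k → ¬ OccursAt u w l) ×
    v ≡ segment u j (k ∸ j)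

{-# OPTIONS --safe #-}

-- A complete return word v w (v ∈ R(w)) starts with w and contains w nowhere else except as a
-- suffix, so the complete return words are the leaves of a trie whose inner nodes are their
-- proper prefixes of length ≥ |w|. An inner node x has at most #Eʳ(x) children, hence
-- #R(w) ≤ 1 + Σ (#Eʳ(x) − 1) over the inner nodes x.
-- Without weak bispecial factors, Σ_{a ∈ Eˡ(x)} (#Eʳ(ax) − 1) ≥ #Eʳ(x) − 1 for every factor x,
-- so the excess #Eʳ(x) − 1 of an inner node survives in its left extensions, up to any length N.
-- An inner node has no inner node as a proper suffix (w would occur strictly inside a complete
-- return word), so the excesses arriving at length N sit on distinct factors and add up to at
-- most Σ_{|y| = N} (#Eʳ(y) − 1) = ΔC(N) < m.

module Submission where

open import Defs
open import Data.Nat using (ℕ; zero; suc; _+_; _*_; _∸_; _≤_; _<_; z≤n; s≤s; _≤?_; _<?_)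
  renaming (_≟_ to _≟ℕ_)
open import Data.Nat.Properties
open import Algebra.Properties.CommutativeSemigroup +-commutativeSemigroup
  using () renaming (interchange to +-interchange)
open import Data.Fin using (Fin) renaming (_≟_ to _≟ᶠ_)
open import Data.List
  using (List; []; _∷_; _∷ʳ_; length; _++_; map; filter; allFin; cartesianProduct; cartesianProductWith)
open import Data.List.Properties using (∷-injective; length-++; length-map; ++-cancelʳ; ≡-dec)
open import Data.List.Relation.Unary.All as All using (All; []; _∷_)
open import Data.List.Relation.Unary.Any using (Any; here; there; any?; satisfied)
open import Data.List.Relation.Unary.Unique.Propositional using (Unique)
open import Data.List.Relation.Unary.Unique.Propositional.Properties
  using (filter⁺; map⁺; cartesianProduct⁺; cartesianProductWith⁺; allFin⁺)
open import Data.List.Relation.Unary.AllPairs using ([]; _∷_)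
open import Data.List.Membership.Propositional using (_∈_; find; lose)
open import Data.List.Membership.Propositional.Properties
  using ( ∈-filter⁺; ∈-filter⁻; ∈-map⁻; ∈-++⁺ˡ; ∈-++⁺ʳ; ∈-allFin
        ; ∈-cartesianProduct⁺; ∈-cartesianProductWith⁺; ∈-cartesianProductWith⁻)
open import Data.Product using (Σ; ∃₂; _×_; _,_; proj₁; proj₂)
open import Data.Nat.Tactic.RingSolver using (solve-∀)
open import Function.Bundles using (mk⇔)
open import Level using (0ℓ)
open import Relation.Binary.Definitions using (DecidableEquality)
open import Relation.Binary.PropositionalEquality
open import Relation.Nullary using (¬_; Dec; yes; no; _×-dec_; ¬¬-excluded-middle; contradiction; decidable-stable)
open import Relation.Nullary.Negation using (¬¬-Monad; ¬¬-map)
open import Relation.Unary using (Decidable)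

-- Sums over lists

module _ {A : Set} where

  ∑ : List A → (A → ℕ) → ℕ
  ∑ []       f = 0
  ∑ (x ∷ xs) f = f x + ∑ xs f

  syntax ∑ xs (λ x → e) = ∑[ x ← xs ] e

  ∑-cong : ∀ xs {f g : A → ℕ} → (∀ x → x ∈ xs → f x ≡ g x) → ∑ xs f ≡ ∑ xs g
  ∑-cong []       f≡g = refl
  ∑-cong (x ∷ xs) f≡g = cong₂ _+_ (f≡g x (here refl)) (∑-cong xs (λ y y∈ → f≡g y (there y∈)))

  ∑-mono-≤ : ∀ xs {f g : A → ℕ} → (∀ x → x ∈ xs → f x ≤ g x) → ∑ xs f ≤ ∑ xs g
  ∑-mono-≤ []       f≤g = z≤n
  ∑-mono-≤ (x ∷ xs) f≤g = +-mono-≤ (f≤g x (here refl)) (∑-mono-≤ xs (λ y y∈ → f≤g y (there y∈)))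

  ∑-zero : ∀ xs {f : A → ℕ} → (∀ x → x ∈ xs → f x ≡ 0) → ∑ xs f ≡ 0
  ∑-zero []       f≡0 = refl
  ∑-zero (x ∷ xs) f≡0 = cong₂ _+_ (f≡0 x (here refl)) (∑-zero xs (λ y y∈ → f≡0 y (there y∈)))

  ∑-one : ∀ xs {f : A → ℕ} → (∀ x → x ∈ xs → f x ≡ 1) → ∑ xs f ≡ length xs
  ∑-one []       f≡1 = refl
  ∑-one (x ∷ xs) f≡1 = cong₂ _+_ (f≡1 x (here refl)) (∑-one xs (λ y y∈ → f≡1 y (there y∈)))

  ∑-distrib-+ : ∀ xs (f g : A → ℕ) → ∑[ x ← xs ] (f x + g x) ≡ ∑ xs f + ∑ xs g
  ∑-distrib-+ []       f g = refl
  ∑-distrib-+ (x ∷ xs) f g =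
    trans (cong (f x + g x +_) (∑-distrib-+ xs f g)) (+-interchange (f x) (g x) (∑ xs f) (∑ xs g))

  ∑-distribˡ-* : ∀ xs c (f : A → ℕ) → ∑[ x ← xs ] (c * f x) ≡ c * ∑ xs f
  ∑-distribˡ-* []       c f = sym (*-zeroʳ c)
  ∑-distribˡ-* (x ∷ xs) c f =
    trans (cong (c * f x +_) (∑-distribˡ-* xs c f)) (sym (*-distribˡ-+ c (f x) (∑ xs f)))

  ≤-∑ : ∀ {xs} (f : A → ℕ) {x} → x ∈ xs → f x ≤ ∑ xs f
  ≤-∑ {y ∷ xs} f (here refl) = m≤m+n (f y) (∑ xs f)
  ≤-∑ {y ∷ xs} f (there x∈)  = ≤-trans (≤-∑ f x∈) (m≤n+m (∑ xs f) (f y))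

  ∑-++ : ∀ xs ys (f : A → ℕ) → ∑ (xs ++ ys) f ≡ ∑ xs f + ∑ ys f
  ∑-++ []       ys f = refl
  ∑-++ (x ∷ xs) ys f = trans (cong (f x +_) (∑-++ xs ys f)) (sym (+-assoc (f x) (∑ xs f) (∑ ys f)))

∑-map : ∀ {A B : Set} (h : A → B) xs (f : B → ℕ) → ∑ (map h xs) f ≡ ∑[ x ← xs ] f (h x)
∑-map h []       f = refl
∑-map h (x ∷ xs) f = cong (f (h x) +_) (∑-map h xs f)

∑-cartesianProductWith : ∀ {A B C : Set} (h : A → B → C) xs ys (f : C → ℕ) →
  ∑ (cartesianProductWith h xs ys) f ≡ ∑[ x ← xs ] ∑[ y ← ys ] f (h x y)
∑-cartesianProductWith h []       ys f = refl
∑-cartesianProductWith h (x ∷ xs) ys f =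
  trans (∑-++ (map (h x) ys) _ f) (cong₂ _+_ (∑-map (h x) ys f) (∑-cartesianProductWith h xs ys f))

∑-comm : ∀ {A B : Set} (xs : List A) (ys : List B) (f : A → B → ℕ) →
  ∑[ x ← xs ] ∑[ y ← ys ] f x y ≡ ∑[ y ← ys ] ∑[ x ← xs ] f x y
∑-comm []       ys f = sym (∑-zero ys (λ _ _ → refl))
∑-comm (x ∷ xs) ys f =
  trans (cong (∑ ys (f x) +_) (∑-comm xs ys f)) (sym (∑-distrib-+ ys (f x) (λ y → ∑[ x′ ← xs ] f x′ y)))

module _ {P : Set} where

  𝟙 : Dec P → ℕ
  𝟙 (yes _) = 1
  𝟙 (no _)  = 0

  𝟙-yes : (P? : Dec P) → P → 𝟙 P? ≡ 1
  𝟙-yes (yes _) p = refl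
  𝟙-yes (no ¬p) p = contradiction p ¬p

  𝟙-no : (P? : Dec P) → ¬ P → 𝟙 P? ≡ 0
  𝟙-no (yes p) ¬p = contradiction p ¬p
  𝟙-no (no _)  ¬p = refl

  𝟙≤1 : (P? : Dec P) → 𝟙 P? ≤ 1
  𝟙≤1 (yes _) = ≤-refl
  𝟙≤1 (no _)  = z≤n

module _ {P Q : Set} where

  𝟙-mono : (P? : Dec P) (Q? : Dec Q) → (P → Q) → 𝟙 P? ≤ 𝟙 Q?
  𝟙-mono (yes p) (yes q) P⇒Q = ≤-refl
  𝟙-mono (yes p) (no ¬q) P⇒Q = contradiction (P⇒Q p) ¬q
  𝟙-mono (no _)  Q?      P⇒Q = z≤n

𝟙-cong : ∀ {P Q : Set} (P? : Dec P) (Q? : Dec Q) → (P → Q) → (Q → P) → 𝟙 P? ≡ 𝟙 Q?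
𝟙-cong P? Q? P⇒Q Q⇒P = ≤-antisym (𝟙-mono P? Q? P⇒Q) (𝟙-mono Q? P? Q⇒P)

module _ {A : Set} {P : A → Set} (P? : Decidable P) where

  length-filter≡∑𝟙 : ∀ xs → length (filter P? xs) ≡ ∑[ x ← xs ] 𝟙 (P? x)
  length-filter≡∑𝟙 []       = refl
  length-filter≡∑𝟙 (x ∷ xs) with P? x
  ... | yes _ = cong suc (length-filter≡∑𝟙 xs)
  ... | no _  = length-filter≡∑𝟙 xs

  hasCard-∑𝟙 : ∀ xs → Unique xs → (∀ x → P x → x ∈ xs) → HasCard P (∑[ x ← xs ] 𝟙 (P? x))
  hasCard-∑𝟙 xs xs-unique P⊆xs =
    filter P? xs , filter⁺ P? xs-unique ,
    (λ x → mk⇔ (λ x∈ → proj₂ (∈-filter⁻ P? {xs = xs} x∈)) (λ px → ∈-filter⁺ P? (P⊆xs x px) px)) ,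
    length-filter≡∑𝟙 xs

module _ {A : Set} (_≟_ : DecidableEquality A) where

  ∑-𝟙≡-≤1 : ∀ {xs} z → Unique xs → ∑[ x ← xs ] 𝟙 (x ≟ z) ≤ 1
  ∑-𝟙≡-≤1 {[]}     z _ = z≤n
  ∑-𝟙≡-≤1 {x ∷ xs} z (x∉xs ∷ xs-unique) with x ≟ z
  ... | no _     = ∑-𝟙≡-≤1 z xs-unique
  ... | yes refl =
    ≤-reflexive (cong suc (∑-zero xs λ y y∈ → 𝟙-no (y ≟ x) λ y≡x → All.lookup x∉xs y∈ (sym y≡x)))

  open import Data.List.Membership.DecPropositional _≟_ using (_∈?_)

  ∑-𝟙-unique-≤ : ∀ {P : A → Set} (P? : Decidable P) {xs} ys →
    Unique xs → (∀ x → x ∈ xs → P x → x ∈ ys) →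
    ∑[ x ← xs ] 𝟙 (P? x) ≤ ∑[ y ← ys ] 𝟙 (y ∈? xs)
  ∑-𝟙-unique-≤ P? {[]}     ys _ _ = z≤n
  ∑-𝟙-unique-≤ P? {x ∷ xs} ys (x∉xs ∷ xs-unique) xs⊆ys = begin
    𝟙 (P? x) + ∑[ x′ ← xs ] 𝟙 (P? x′)
      ≤⟨ +-mono-≤ head≤ (∑-𝟙-unique-≤ P? ys xs-unique (λ x′ x′∈ → xs⊆ys x′ (there x′∈))) ⟩
    ∑[ y ← ys ] 𝟙 (y ≟ x) + ∑[ y ← ys ] 𝟙 (y ∈? xs)
      ≡⟨ ∑-distrib-+ ys _ _ ⟨
    ∑[ y ← ys ] (𝟙 (y ≟ x) + 𝟙 (y ∈? xs))
      ≤⟨ ∑-mono-≤ ys (λ y _ → split y (y ≟ x)) ⟩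
    ∑[ y ← ys ] 𝟙 (y ∈? x ∷ xs) ∎
    where
    open ≤-Reasoning
    head≤ : 𝟙 (P? x) ≤ ∑[ y ← ys ] 𝟙 (y ≟ x)
    head≤ with P? x
    ... | no _   = z≤n
    ... | yes px =
      ≤-trans (≤-reflexive (sym (𝟙-yes (x ≟ x) refl))) (≤-∑ (λ y → 𝟙 (y ≟ x)) (xs⊆ys x (here refl) px))
    split : ∀ y (y≟x : Dec (y ≡ x)) → 𝟙 y≟x + 𝟙 (y ∈? xs) ≤ 𝟙 (y ∈? x ∷ xs)
    split y (yes refl) = ≤-reflexive (trans (cong suc (𝟙-no (y ∈? xs) (λ y∈ → All.lookup x∉xs y∈ refl)))
                                             (sym (𝟙-yes (y ∈? y ∷ xs) (here refl))))
    split y (no _)     = 𝟙-mono (y ∈? xs) (y ∈? x ∷ xs) there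

n≡0⇒m*n≡0 : ∀ m {n} → n ≡ 0 → m * n ≡ 0
n≡0⇒m*n≡0 m refl = *-zeroʳ m

m*n+o≤n+m : ∀ {m n o} → m ≤ 1 → o ≤ n → o ≤ 1 → m * n + o ≤ n + m
m*n+o≤n+m {zero}     {n}     _ o≤n _   = ≤-trans o≤n (m≤m+n n 0)
m*n+o≤n+m {suc zero} {n} {o} _ _   o≤1 = ≤-trans (≤-reflexive (cong (_+ o) (+-identityʳ n))) (+-monoʳ-≤ n o≤1)
m*n+o≤n+m {suc (suc _)} (s≤s ())

-- Words and segments

length-∷ʳ : ∀ {A : Set} (xs : List A) x → length (xs ∷ʳ x) ≡ suc (length xs)
length-∷ʳ xs x = trans (length-++ xs) (+-comm (length xs) 1)

module _ {k : ℕ} where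

  letters : List (Fin k)
  letters = allFin k

  words : ℕ → List (FWord k)
  words zero    = [] ∷ []
  words (suc n) = cartesianProductWith _∷_ letters (words n)

  words-unique : ∀ n → Unique (words n)
  words-unique zero    = [] ∷ []
  words-unique (suc n) = cartesianProductWith⁺ _∷_ ∷-injective (allFin⁺ k) (words-unique n)

  ∈-words : ∀ v → v ∈ words (length v)
  ∈-words []      = here refl
  ∈-words (a ∷ v) = ∈-cartesianProductWith⁺ _∷_ (∈-allFin a) (∈-words v)

  ∈-words⇒length : ∀ n {v} → v ∈ words n → length v ≡ n
  ∈-words⇒length zero    (here refl) = refl
  ∈-words⇒length (suc n) v∈ with ∈-cartesianProductWith⁻ _∷_ letters (words n) v∈
  ... | _ , _ , _ , v′∈ , refl = cong suc (∈-words⇒length n v′∈)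

  ∑-words-cong : ∀ n {f g : FWord k → ℕ} →
    (∀ v → length v ≡ n → f v ≡ g v) → ∑ (words n) f ≡ ∑ (words n) g
  ∑-words-cong n f≡g = ∑-cong (words n) (λ v v∈ → f≡g v (∈-words⇒length n v∈))

  ∑-words-mono-≤ : ∀ n {f g : FWord k → ℕ} →
    (∀ v → length v ≡ n → f v ≤ g v) → ∑ (words n) f ≤ ∑ (words n) g
  ∑-words-mono-≤ n f≤g = ∑-mono-≤ (words n) (λ v v∈ → f≤g v (∈-words⇒length n v∈))

  ∑-words-zero : ∀ n {f : FWord k → ℕ} → (∀ v → length v ≡ n → f v ≡ 0) → ∑ (words n) f ≡ 0
  ∑-words-zero n f≡0 = ∑-zero (words n) (λ v v∈ → f≡0 v (∈-words⇒length n v∈))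

  ∑-words-∷ : ∀ n (f : FWord k → ℕ) →
    ∑ (words (suc n)) f ≡ ∑[ v ← words n ] ∑[ a ← letters ] f (a ∷ v)
  ∑-words-∷ n f =
    trans (∑-cartesianProductWith _∷_ letters (words n) f) (∑-comm letters (words n) (λ a v → f (a ∷ v)))

  ∑-words-∷ʳ : ∀ n (f : FWord k → ℕ) →
    ∑ (words (suc n)) f ≡ ∑[ v ← words n ] ∑[ b ← letters ] f (v ∷ʳ b)
  ∑-words-∷ʳ zero    f = trans (∑-cartesianProductWith _∷_ letters (words 0) f)
                               (trans (∑-cong letters (λ a _ → +-identityʳ (f (a ∷ [])))) (sym (+-identityʳ _)))
  ∑-words-∷ʳ (suc n) f = begin
    ∑ (words (suc (suc n))) f
      ≡⟨ ∑-cartesianProductWith _∷_ letters (words (suc n)) f ⟩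
    ∑[ a ← letters ] ∑[ v ← words (suc n) ] f (a ∷ v)
      ≡⟨ ∑-cong letters (λ a _ → ∑-words-∷ʳ n (λ v → f (a ∷ v))) ⟩
    ∑[ a ← letters ] ∑[ v ← words n ] ∑[ b ← letters ] f ((a ∷ v) ∷ʳ b)
      ≡⟨ ∑-cartesianProductWith _∷_ letters (words n) (λ v → ∑[ b ← letters ] f (v ∷ʳ b)) ⟨
    ∑[ v ← words (suc n) ] ∑[ b ← letters ] f (v ∷ʳ b) ∎
    where open ≡-Reasoning

  wordsUpTo : ℕ → List (FWord k)
  wordsUpTo zero    = words zero
  wordsUpTo (suc n) = words (suc n) ++ wordsUpTo n

  ∈-wordsUpTo : ∀ n {v} → length v ≤ n → v ∈ wordsUpTo n
  ∈-wordsUpTo zero    {[]} z≤n = here refl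
  ∈-wordsUpTo (suc n) {v} |v|≤1+n with length v ≤? n
  ... | yes |v|≤n = ∈-++⁺ʳ (words (suc n)) (∈-wordsUpTo n |v|≤n)
  ... | no  |v|≰n = ∈-++⁺ˡ (subst (λ m → v ∈ words m) (≤-antisym |v|≤1+n (≰⇒> |v|≰n)) (∈-words v))

  ¬¬-decideUpTo : ∀ (P : FWord k → Set) n → ¬ ¬ (∀ v → length v ≤ n → Dec (P v))
  ¬¬-decideUpTo P n = ¬¬-map (λ decs v |v|≤n → All.lookup decs (∈-wordsUpTo n |v|≤n))
    (All.sequenceM 0ℓ ¬¬-Monad (All.universal (λ v → ¬¬-excluded-middle {A = P v}) (wordsUpTo n)))

module _ {k : ℕ} (u : InfWord k) where

  length-segment : ∀ i n → length (segment u i n) ≡ n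
  length-segment i zero    = refl
  length-segment i (suc n) = cong suc (length-segment (suc i) n)

  segment-+ : ∀ i m n → segment u i (m + n) ≡ segment u i m ++ segment u (i + m) n
  segment-+ i zero    n = cong (λ j → segment u j n) (sym (+-identityʳ i))
  segment-+ i (suc m) n = cong (u i ∷_) (trans (segment-+ (suc i) m n)
    (cong (λ j → segment u (suc i) m ++ segment u j n) (sym (+-suc i m))))

  segment-++⁻ : ∀ i (x z : FWord k) n → x ++ z ≡ segment u i n →
    x ≡ segment u i (length x) × z ≡ segment u (i + length x) (length z)
  segment-++⁻ i []      z n       z≡ = refl ,
    subst₂ (λ j m → z ≡ segment u j m) (sym (+-identityʳ i))
      (sym (trans (cong length z≡) (length-segment i n))) z≡
  segment-++⁻ i (a ∷ x) z zero    ()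
  segment-++⁻ i (a ∷ x) z (suc n) ax++z≡ with ∷-injective ax++z≡
  ... | a≡ , x++z≡ with segment-++⁻ (suc i) x z n x++z≡
  ...   | x≡ , z≡ =
    cong₂ _∷_ a≡ x≡ , trans z≡ (cong (λ j → segment u j (length z)) (sym (+-suc i (length x))))

  segment-prefix-≡ : ∀ i i′ m n →
    segment u i (m + n) ≡ segment u i′ (m + n) → segment u i m ≡ segment u i′ m
  segment-prefix-≡ i i′ zero    n _ = refl
  segment-prefix-≡ i i′ (suc m) n ≡seg with ∷-injective ≡seg
  ... | head≡ , tail≡ = cong₂ _∷_ head≡ (segment-prefix-≡ (suc i) (suc i′) m n tail≡)

  segment-suffix-≡ : ∀ i i′ m n →
    segment u i (m + n) ≡ segment u i′ (m + n) → segment u (i + m) n ≡ segment u (i′ + m) n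
  segment-suffix-≡ i i′ zero    n ≡seg =
    subst₂ (λ j j′ → segment u j n ≡ segment u j′ n) (sym (+-identityʳ i)) (sym (+-identityʳ i′)) ≡seg
  segment-suffix-≡ i i′ (suc m) n ≡seg =
    subst₂ (λ j j′ → segment u j n ≡ segment u j′ n) (sym (+-suc i m)) (sym (+-suc i′ m))
      (segment-suffix-≡ (suc i) (suc i′) m n (proj₂ (∷-injective ≡seg)))

  factor-++⁻ˡ : ∀ x z → Factor u (x ++ z) → Factor u x
  factor-++⁻ˡ x z (i , occ) = i , sym (proj₁ (segment-++⁻ i x z _ (sym occ)))

  factor-++⁻ʳ : ∀ x z → Factor u (x ++ z) → Factor u z
  factor-++⁻ʳ x z (i , occ) = i + length x , sym (proj₂ (segment-++⁻ i x z _ (sym occ)))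

  factor-extendʳ : ∀ x → Factor u x → Σ (Fin k) λ b → Factor u (x ∷ʳ b)
  factor-extendʳ x (i , occ) = u (i + length x) , i ,
    trans (cong (segment u i) (length-++ x)) (trans (segment-+ i (length x) 1) (cong (_++ u (i + length x) ∷ []) occ))

-- Return words

module ReturnWords {k : ℕ} (u : InfWord k) (w : FWord k) where

  record ReturnOccurrence : Set where
    field
      start gap             : ℕ
      gap>0                 : 0 < gap
      occurs-start          : OccursAt u w start
      occurs-next           : OccursAt u w (start + gap)
      no-occurrence-between : ∀ p → 0 < p → p < gap → ¬ OccursAt u w (start + p)

    completeLength : ℕ
    completeLength = gap + length w

    complete : FWord k
    complete = segment u start completeLength

  open ReturnOccurrence public

  returnOccurrence : ∀ v → ReturnWord u w v → Σ ReturnOccurrence λ d → complete d ≡ v ++ w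
  returnOccurrence v (i , j , i<j , occ-i , occ-j , none-between , v≡) = d , complete≡
    where
    i+[j∸i]≡j : i + (j ∸ i) ≡ j
    i+[j∸i]≡j = m+[n∸m]≡n (<⇒≤ i<j)
    d : ReturnOccurrence
    d = record
      { start = i ; gap = j ∸ i ; gap>0 = m<n⇒0<n∸m i<j ; occurs-start = occ-i
      ; occurs-next = subst (OccursAt u w) (sym i+[j∸i]≡j) occ-j
      ; no-occurrence-between = λ p p>0 p<gap →
          none-between (i + p) (m<m+n i p>0) (subst (i + p <_) i+[j∸i]≡j (+-monoʳ-< i p<gap)) }
    complete≡ : complete d ≡ v ++ w
    complete≡ = trans (segment-+ u i (j ∸ i) (length w))
                      (cong₂ _++_ (sym v≡) (trans (cong (λ l → segment u l (length w)) i+[j∸i]≡j) occ-j))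

  returnOccurrences : ∀ L → Unique L → All (ReturnWord u w) L →
    Σ (List ReturnOccurrence) λ ds → Unique (map complete ds) × length ds ≡ length L
  returnOccurrences L L-unique L-returns =
    let ds , ds≡ = collect L L-returns
    in ds , subst Unique (sym ds≡) (map⁺ (++-cancelʳ w _ _) L-unique) ,
       trans (sym (length-map complete ds)) (trans (cong length ds≡) (length-map (_++ w) L))
    where
    collect : ∀ L → All (ReturnWord u w) L → Σ (List ReturnOccurrence) λ ds → map complete ds ≡ map (_++ w) L
    collect []      []         = [] , refl
    collect (v ∷ L) (rv ∷ rL) with returnOccurrence v rv | collect L rL
    ... | d , d≡ | ds , ds≡ = d ∷ ds , cong₂ _∷_ d≡ ds≡

  lengthBound : List ReturnOccurrence → ℕ
  lengthBound ds = ∑ ds completeLength + length w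

  module Counting
    (ds : List ReturnOccurrence) (ds-distinct : Unique (map complete ds))
    (factor? : ∀ v → length v ≤ suc (lengthBound ds) → Dec (Factor u v))
    (no-weak-bispecial : ∀ x → ¬ WeakBispecial u x)
    where

    N : ℕ
    N = lengthBound ds

    complete≤N : ∀ d → d ∈ ds → completeLength d ≤ N
    complete≤N d d∈ds = ≤-trans (≤-∑ completeLength d∈ds) (m≤m+n _ (length w))

    |w|≤N : length w ≤ N
    |w|≤N = m≤n+m (length w) _

    -- Membership is only decided up to length N + 1, so χ ignores longer factors.
    Factor≤ : FWord k → Set
    Factor≤ v = Factor u v × length v ≤ suc N

    factor≤? : ∀ v → Dec (Factor≤ v)
    factor≤? v with length v ≤? suc N
    ... | no  |v|≰ = no (λ fv → |v|≰ (proj₂ fv))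
    ... | yes |v|≤ with factor? v |v|≤
    ...   | yes fv = yes (fv , |v|≤)
    ...   | no ¬fv = no (λ fv → ¬fv (proj₁ fv))

    χ : FWord k → ℕ
    χ v = 𝟙 (factor≤? v)

    𝟙-factor?≡χ : ∀ v |v|≤ → 𝟙 (factor? v |v|≤) ≡ χ v
    𝟙-factor?≡χ v |v|≤ = 𝟙-cong (factor? v |v|≤) (factor≤? v) (_, |v|≤) proj₁

    χ-factor : ∀ {v} → Factor u v → length v ≤ suc N → χ v ≡ 1
    χ-factor fv |v|≤ = 𝟙-yes (factor≤? _) (fv , |v|≤)

    χ≤1 : ∀ v → χ v ≤ 1
    χ≤1 v = 𝟙≤1 (factor≤? v)

    Factor≤-++⁻ˡ : ∀ x z → Factor≤ (x ++ z) → Factor≤ x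
    Factor≤-++⁻ˡ x z (fxz , |xz|≤) =
      factor-++⁻ˡ u x z fxz ,
      ≤-trans (≤-trans (m≤m+n (length x) (length z)) (≤-reflexive (sym (length-++ x)))) |xz|≤

    Factor≤-++⁻ʳ : ∀ x z → Factor≤ (x ++ z) → Factor≤ z
    Factor≤-++⁻ʳ x z (fxz , |xz|≤) =
      factor-++⁻ʳ u x z fxz ,
      ≤-trans (≤-trans (m≤n+m (length z) (length x)) (≤-reflexive (sym (length-++ x)))) |xz|≤

    #Eʳ #Eˡ #B : FWord k → ℕ
    #Eʳ x = ∑[ b ← letters ] χ (x ∷ʳ b)
    #Eˡ x = ∑[ a ← letters ] χ (a ∷ x)
    #B  x = ∑[ a ← letters ] #Eʳ (a ∷ x)

    #Eʳ-nonfactor : ∀ x → ¬ Factor≤ x → #Eʳ x ≡ 0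
    #Eʳ-nonfactor x ¬fx =
      ∑-zero letters λ b _ → 𝟙-no (factor≤? _) λ fxb → ¬fx (Factor≤-++⁻ˡ x (b ∷ []) fxb)

    #Eˡ-nonfactor : ∀ x → ¬ Factor≤ x → #Eˡ x ≡ 0
    #Eˡ-nonfactor x ¬fx =
      ∑-zero letters λ a _ → 𝟙-no (factor≤? _) λ fax → ¬fx (Factor≤-++⁻ʳ (a ∷ []) x fax)

    χ*#Eʳ : ∀ x → χ x * #Eʳ x ≡ #Eʳ x
    χ*#Eʳ x with factor≤? x
    ... | yes _  = *-identityˡ (#Eʳ x)
    ... | no ¬fx = sym (#Eʳ-nonfactor x ¬fx)

    χ≤#Eʳ : ∀ x → length x ≤ N → χ x ≤ #Eʳ x
    χ≤#Eʳ x |x|≤N with factor≤? x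
    ... | no _ = z≤n
    ... | yes (fx , _) with factor-extendʳ u x fx
    ...   | b , fxb =
      ≤-trans (≤-reflexive (sym (χ-factor fxb |xb|≤))) (≤-∑ (λ b → χ (x ∷ʳ b)) (∈-allFin b))
      where
      |xb|≤ : length (x ∷ʳ b) ≤ suc N
      |xb|≤ = ≤-trans (≤-reflexive (length-∷ʳ x b)) (s≤s |x|≤N)

    bilateral : ∀ x → length x < N → #Eˡ x + #Eʳ x ≤ #B x + 1
    bilateral x |x|<N with factor≤? x
    ... | no ¬fx = ≤-trans (≤-reflexive (cong₂ _+_ (#Eˡ-nonfactor x ¬fx) (#Eʳ-nonfactor x ¬fx))) z≤n
    ... | yes (fx , _) =
      subst₂ _≤_ (cong₂ _+_ #left≡ #right≡) (cong (_+ 1) #bi≡)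
        (≮⇒≥ λ weak → no-weak-bispecial x (fx , _ , _ , _ , card-bi , card-left , card-right , weak))
      where
      |xb|≤ : ∀ b → length (x ∷ʳ b) ≤ suc N
      |xb|≤ b = ≤-trans (≤-reflexive (length-∷ʳ x b)) (m≤n⇒m≤1+n |x|<N)
      |ax|≤ : ∀ a → length (a ∷ x) ≤ suc N
      |ax|≤ a = s≤s (<⇒≤ |x|<N)
      |axb|≤ : ∀ a b → length ((a ∷ x) ∷ʳ b) ≤ suc N
      |axb|≤ a b = s≤s (≤-trans (≤-reflexive (length-∷ʳ x b)) |x|<N)
      bi? : Decidable (BiExt u x)
      bi? (a , b) = factor? ((a ∷ x) ∷ʳ b) (|axb|≤ a b)
      card-bi : HasCard (BiExt u x) (∑[ ab ← cartesianProduct letters letters ] 𝟙 (bi? ab))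
      card-bi = hasCard-∑𝟙 bi? (cartesianProduct letters letters) (cartesianProduct⁺ (allFin⁺ k) (allFin⁺ k))
                  (λ (a , b) _ → ∈-cartesianProduct⁺ (∈-allFin a) (∈-allFin b))
      card-left : HasCard (LeftExt u x) (∑[ a ← letters ] 𝟙 (factor? (a ∷ x) (|ax|≤ a)))
      card-left = hasCard-∑𝟙 (λ a → factor? (a ∷ x) (|ax|≤ a)) letters (allFin⁺ k) (λ a _ → ∈-allFin a)
      card-right : HasCard (RightExt u x) (∑[ b ← letters ] 𝟙 (factor? (x ∷ʳ b) (|xb|≤ b)))
      card-right = hasCard-∑𝟙 (λ b → factor? (x ∷ʳ b) (|xb|≤ b)) letters (allFin⁺ k) (λ b _ → ∈-allFin b)
      #bi≡ : ∑[ ab ← cartesianProduct letters letters ] 𝟙 (bi? ab) ≡ #B x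
      #bi≡ = trans (∑-cartesianProductWith _,_ letters letters (λ ab → 𝟙 (bi? ab)))
               (∑-cong letters (λ a _ → ∑-cong letters (λ b _ → 𝟙-factor?≡χ _ (|axb|≤ a b))))
      #left≡ : ∑[ a ← letters ] 𝟙 (factor? (a ∷ x) (|ax|≤ a)) ≡ #Eˡ x
      #left≡ = ∑-cong letters (λ a _ → 𝟙-factor?≡χ _ (|ax|≤ a))
      #right≡ : ∑[ b ← letters ] 𝟙 (factor? (x ∷ʳ b) (|xb|≤ b)) ≡ #Eʳ x
      #right≡ = ∑-cong letters (λ b _ → 𝟙-factor?≡χ _ (|xb|≤ b))

    complexity : ∀ n → n ≤ suc N → FactorComplexity u n (∑ (words n) χ)
    complexity n n≤ = subst (HasCard _) (∑-words-cong n (λ v |v|≡n → 𝟙-cong (factor-of-length? v) (factor≤? v)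
                          (λ (fv , |v|≡n) → fv , subst (_≤ suc N) (sym |v|≡n) n≤) (λ (fv , _) → fv , |v|≡n)))
      (hasCard-∑𝟙 factor-of-length? (words n) (words-unique n)
        (λ v (_ , |v|≡n) → subst (λ l → v ∈ words l) |v|≡n (∈-words v)))
      where
      factor-of-length? : ∀ v → Dec (Factor u v × length v ≡ n)
      factor-of-length? v with length v ≟ℕ n
      ... | no |v|≢n = no (λ fv → |v|≢n (proj₂ fv))
      ... | yes |v|≡n with factor? v (subst (_≤ suc N) (sym |v|≡n) n≤)
      ...   | yes fv = yes (fv , |v|≡n)
      ...   | no ¬fv = no (λ fv → ¬fv (proj₁ fv))

    -- The trie of complete return words

    returns : List (FWord k)
    returns = map complete ds

    _≟ʷ_ : DecidableEquality (FWord k)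
    _≟ʷ_ = ≡-dec _≟ᶠ_

    open import Data.List.Membership.DecPropositional _≟ʷ_ using (_∈?_)

    -- y is an inner node of the trie of complete return words, on the branch of d.
    InnerPrefix : FWord k → ReturnOccurrence → Set
    InnerPrefix y d = length w ≤ length y × length y < completeLength d × y ≡ segment u (start d) (length y)

    innerPrefix? : ∀ y d → Dec (InnerPrefix y d)
    innerPrefix? y d =
      (length w ≤? length y) ×-dec (length y <? completeLength d) ×-dec (y ≟ʷ segment u (start d) (length y))

    inner leaf : FWord k → ℕ
    inner y = 𝟙 (any? (innerPrefix? y) ds)
    leaf  y = 𝟙 (y ∈? returns)

    inner≡1 : ∀ {y d} → d ∈ ds → InnerPrefix y d → inner y ≡ 1
    inner≡1 d∈ds inner-y = 𝟙-yes (any? (innerPrefix? _) ds) (lose d∈ds inner-y)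

    inner-short : ∀ y → length y < length w → inner y ≡ 0
    inner-short y |y|<|w| =
      𝟙-no (any? (innerPrefix? y) ds) λ any-inner → <⇒≱ |y|<|w| (proj₁ (proj₂ (satisfied any-inner)))

    inner≤𝟙≡w : ∀ y → length y ≡ length w → inner y ≤ 𝟙 (y ≟ʷ w)
    inner≤𝟙≡w y |y|≡|w| = 𝟙-mono (any? (innerPrefix? y) ds) (y ≟ʷ w) λ any-inner →
      let d , _ , _ , y≡ = satisfied any-inner
      in trans y≡ (trans (cong (segment u (start d)) |y|≡|w|) (occurs-start d))

    inner-not-complete : ∀ y → Any (InnerPrefix y) ds → ¬ y ∈ returns
    inner-not-complete y any-inner y∈returns with satisfied any-inner | ∈-map⁻ complete y∈returns
    ... | d , _ , |y|< , y≡ | d′ , _ , y≡complete =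
      no-occurrence-between d (gap d′) (gap>0 d′)
        (+-cancelʳ-< (length w) (gap d′) (gap d) (subst (_< completeLength d) |y|≡ |y|<)) occurs
      where
      |y|≡ : length y ≡ completeLength d′
      |y|≡ = trans (cong length y≡complete) (length-segment u _ _)
      same-segment : segment u (start d) (completeLength d′) ≡ complete d′
      same-segment = trans (subst (λ l → segment u (start d) l ≡ y) |y|≡ (sym y≡)) y≡complete
      occurs : OccursAt u w (start d + gap d′)
      occurs = trans (segment-suffix-≡ u (start d) (start d′) (gap d′) (length w) same-segment) (occurs-next d′)

    extends-inner : ∀ x b {d} → length w ≤ length x → d ∈ ds → length (x ∷ʳ b) ≤ completeLength d →
      x ∷ʳ b ≡ segment u (start d) (length (x ∷ʳ b)) → inner x * χ (x ∷ʳ b) ≡ 1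
    extends-inner x b {d} |w|≤|x| d∈ds |xb|≤ xb≡ = cong₂ _*_
      (inner≡1 d∈ds ( |w|≤|x| , ≤-trans (≤-reflexive (sym (length-∷ʳ x b))) |xb|≤
                    , proj₁ (segment-++⁻ u (start d) x (b ∷ []) _ xb≡)))
      (χ-factor (start d , sym xb≡) (≤-trans |xb|≤ (m≤n⇒m≤1+n (complete≤N d d∈ds))))

    children : ∀ x b → length w ≤ length x → inner (x ∷ʳ b) + leaf (x ∷ʳ b) ≤ inner x * χ (x ∷ʳ b)
    children x b |w|≤|x| with any? (innerPrefix? (x ∷ʳ b)) ds | (x ∷ʳ b) ∈? returns
    ... | yes any-inner | yes xb∈returns = contradiction xb∈returns (inner-not-complete _ any-inner)
    ... | no _          | no _           = z≤n
    ... | yes any-inner | no _ =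
      let d , d∈ds , _ , |xb|< , xb≡ = find any-inner
      in ≤-reflexive (sym (extends-inner x b |w|≤|x| d∈ds (<⇒≤ |xb|<) xb≡))
    ... | no _          | yes xb∈returns =
      let d , d∈ds , xb≡ = ∈-map⁻ complete xb∈returns
          |xb|≡ = trans (cong length xb≡) (length-segment u _ _)
      in ≤-reflexive (sym (extends-inner x b |w|≤|x| d∈ds (≤-reflexive |xb|≡)
                            (trans xb≡ (cong (segment u (start d)) (sym |xb|≡)))))

    inner-no-inner-proper-suffix : ∀ a p s → Any (InnerPrefix (a ∷ p ++ s)) ds → ¬ Any (InnerPrefix s) ds
    inner-no-inner-proper-suffix a p s any-aps any-s with satisfied any-aps | satisfied any-s
    ... | d , _ , |aps|< , aps≡ | d′ , |w|≤|s| , _ , s≡ =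
      no-occurrence-between d (suc (length p)) (s≤s z≤n) 1+|p|<gap occurs
      where
      open ≤-Reasoning using (begin-strict_; step-≤; step-≡-⟨; step-<; _∎)
      |s|≡ : length w + (length s ∸ length w) ≡ length s
      |s|≡ = m+[n∸m]≡n |w|≤|s|
      s-occurs : segment u (start d + suc (length p)) (length s) ≡ segment u (start d′) (length s)
      s-occurs = trans (sym (proj₂ (segment-++⁻ u (start d) (a ∷ p) s _ aps≡))) s≡
      occurs : OccursAt u w (start d + suc (length p))
      occurs = trans (segment-prefix-≡ u _ _ (length w) _
                       (subst (λ l → segment u _ l ≡ segment u _ l) (sym |s|≡) s-occurs))
                     (occurs-start d′)
      1+|p|<gap : suc (length p) < gap d
      1+|p|<gap = +-cancelʳ-< (length w) (suc (length p)) (gap d) (begin-strict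
        suc (length p) + length w ≤⟨ +-monoʳ-≤ (suc (length p)) |w|≤|s| ⟩
        suc (length p) + length s ≡⟨ cong suc (length-++ p) ⟨
        length (a ∷ p ++ s)       <⟨ |aps|< ⟩
        completeLength d          ∎)

    -- innerSuffixes y counts the suffixes of y that are inner nodes, a proper one only if y is a factor;
    -- y is covered when innerProperSuffixes y = 1.
    mutual
      innerSuffixes : FWord k → ℕ
      innerSuffixes y = inner y + innerProperSuffixes y

      innerProperSuffixes : FWord k → ℕ
      innerProperSuffixes []      = 0
      innerProperSuffixes (a ∷ x) = χ (a ∷ x) * innerSuffixes x

    has-inner-suffix : ∀ x → innerSuffixes x ≢ 0 → ∃₂ λ p s → x ≡ p ++ s × Any (InnerPrefix s) ds
    has-inner-suffix x #≢0 with any? (innerPrefix? x) ds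
    ... | yes any-inner = [] , x , refl , any-inner
    has-inner-suffix []      #≢0 | no _ = contradiction refl #≢0
    has-inner-suffix (a ∷ x) #≢0 | no _ =
      let p , s , x≡ , any-inner = has-inner-suffix x (λ #≡0 → #≢0 (n≡0⇒m*n≡0 (χ (a ∷ x)) #≡0))
      in a ∷ p , s , cong (a ∷_) x≡ , any-inner

    inner⇒innerSuffixes≡0 : ∀ a x → Any (InnerPrefix (a ∷ x)) ds → innerSuffixes x ≡ 0
    inner⇒innerSuffixes≡0 a x any-ax = decidable-stable (innerSuffixes x ≟ℕ 0) λ #≢0 →
      let p , s , x≡ , any-s = has-inner-suffix x #≢0
      in inner-no-inner-proper-suffix a p s (subst (λ y → Any (InnerPrefix (a ∷ y)) ds) x≡ any-ax) any-s

    innerSuffixes≤1 : ∀ y → innerSuffixes y ≤ 1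
    innerSuffixes≤1 []      = ≤-trans (≤-reflexive (+-identityʳ (inner []))) (𝟙≤1 (any? (innerPrefix? []) ds))
    innerSuffixes≤1 (a ∷ x) with any? (innerPrefix? (a ∷ x)) ds
    ... | yes any-ax = ≤-reflexive (cong suc (n≡0⇒m*n≡0 (χ (a ∷ x)) (inner⇒innerSuffixes≡0 a x any-ax)))
    ... | no _       = *-mono-≤ (χ≤1 (a ∷ x)) (innerSuffixes≤1 x)

    innerProperSuffixes≤1 : ∀ y → innerProperSuffixes y ≤ 1
    innerProperSuffixes≤1 []      = z≤n
    innerProperSuffixes≤1 (a ∷ x) = *-mono-≤ (χ≤1 (a ∷ x)) (innerSuffixes≤1 x)

    innerSuffixes-short : ∀ y → length y < length w → innerSuffixes y ≡ 0
    innerProperSuffixes-short : ∀ y → length y ≤ length w → innerProperSuffixes y ≡ 0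
    innerSuffixes-short y |y|<|w| = cong₂ _+_ (inner-short y |y|<|w|) (innerProperSuffixes-short y (<⇒≤ |y|<|w|))
    innerProperSuffixes-short []      _ = refl
    innerProperSuffixes-short (a ∷ x) |ax|≤|w| = n≡0⇒m*n≡0 (χ (a ∷ x)) (innerSuffixes-short x |ax|≤|w|)

    -- Counting length by length

    #returnsUpTo : ℕ → ℕ
    #returnsUpTo ℓ = ∑[ R ← returns ] 𝟙 (length R ≤? ℓ)

    #returnsOfLength : ℕ → ℕ
    #returnsOfLength n = ∑[ R ← returns ] 𝟙 (length R ≟ℕ n)

    length-returns : ∀ {R} → R ∈ returns → Σ ReturnOccurrence λ d → d ∈ ds × length R ≡ completeLength d
    length-returns R∈returns =
      let d , d∈ds , R≡ = ∈-map⁻ complete R∈returns in d , d∈ds , trans (cong length R≡) (length-segment u _ _)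

    #returnsUpTo-suc : ∀ ℓ → #returnsUpTo (suc ℓ) ≤ #returnsUpTo ℓ + #returnsOfLength (suc ℓ)
    #returnsUpTo-suc ℓ =
      ≤-trans (∑-mono-≤ returns (λ R _ → split (length R))) (≤-reflexive (∑-distrib-+ returns _ _))
      where
      split : ∀ n → 𝟙 (n ≤? suc ℓ) ≤ 𝟙 (n ≤? ℓ) + 𝟙 (n ≟ℕ suc ℓ)
      split n with n ≤? suc ℓ
      ... | no _    = z≤n
      ... | yes n≤ with n ≤? ℓ
      ...   | yes _  = s≤s z≤n
      ...   | no n≰ℓ = ≤-reflexive (sym (𝟙-yes (n ≟ℕ suc ℓ) (≤-antisym n≤ (≰⇒> n≰ℓ))))

    #returnsUpTo-|w| : #returnsUpTo (length w) ≡ 0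
    #returnsUpTo-|w| = ∑-zero returns λ R R∈ → 𝟙-no (length R ≤? length w) λ |R|≤|w| →
      let d , _ , |R|≡ = length-returns R∈
      in <⇒≱ (subst (length w <_) (sym |R|≡) (m<n+m (length w) (gap>0 d))) |R|≤|w|

    #returnsUpTo-N : #returnsUpTo N ≡ length ds
    #returnsUpTo-N = trans (∑-one returns λ R R∈ → 𝟙-yes (length R ≤? N) (|R|≤N R∈)) (length-map complete ds)
      where
      |R|≤N : ∀ {R} → R ∈ returns → length R ≤ N
      |R|≤N R∈ = let d , d∈ds , |R|≡ = length-returns R∈ in subst (_≤ N) (sym |R|≡) (complete≤N d d∈ds)

    #returnsOfLength≤∑leaf : ∀ n → #returnsOfLength n ≤ ∑ (words n) leaf
    #returnsOfLength≤∑leaf n = ∑-𝟙-unique-≤ _≟ʷ_ (λ R → length R ≟ℕ n) (words n) ds-distinct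
      (λ R _ |R|≡n → subst (λ l → R ∈ words l) |R|≡n (∈-words R))

    #inner #covered #innerExt #coveredExt : ℕ → ℕ
    #inner     ℓ = ∑ (words ℓ) inner
    #covered   ℓ = ∑ (words ℓ) innerProperSuffixes
    #innerExt  ℓ = ∑[ x ← words ℓ ] (inner x * #Eʳ x)
    #coveredExt ℓ = ∑[ x ← words ℓ ] (innerProperSuffixes x * #Eʳ x)

    ∑-inner+leaf-suc : ∀ ℓ → length w ≤ ℓ → #inner (suc ℓ) + ∑ (words (suc ℓ)) leaf ≤ #innerExt ℓ
    ∑-inner+leaf-suc ℓ |w|≤ℓ = begin
      #inner (suc ℓ) + ∑ (words (suc ℓ)) leaf
        ≡⟨ ∑-distrib-+ (words (suc ℓ)) inner leaf ⟨
      ∑[ y ← words (suc ℓ) ] (inner y + leaf y)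
        ≡⟨ ∑-words-∷ʳ ℓ _ ⟩
      ∑[ x ← words ℓ ] ∑[ b ← letters ] (inner (x ∷ʳ b) + leaf (x ∷ʳ b))
        ≤⟨ ∑-words-mono-≤ ℓ (λ x |x|≡ℓ → ∑-mono-≤ letters λ b _ →
             children x b (subst (length w ≤_) (sym |x|≡ℓ) |w|≤ℓ)) ⟩
      ∑[ x ← words ℓ ] ∑[ b ← letters ] (inner x * χ (x ∷ʳ b))
        ≡⟨ ∑-cong (words ℓ) (λ x _ → ∑-distribˡ-* (letters {k}) (inner x) _) ⟩
      #innerExt ℓ ∎
      where open ≤-Reasoning

    inner+returns-suc : ∀ ℓ → length w ≤ ℓ →
      #inner (suc ℓ) + #returnsUpTo (suc ℓ) ≤ #innerExt ℓ + #returnsUpTo ℓ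
    inner+returns-suc ℓ |w|≤ℓ = begin
      #inner (suc ℓ) + #returnsUpTo (suc ℓ)
        ≤⟨ +-monoʳ-≤ (#inner (suc ℓ))
             (≤-trans (#returnsUpTo-suc ℓ) (+-monoʳ-≤ (#returnsUpTo ℓ) (#returnsOfLength≤∑leaf (suc ℓ)))) ⟩
      #inner (suc ℓ) + (#returnsUpTo ℓ + ∑ (words (suc ℓ)) leaf)
        ≡⟨ shuffle (#inner (suc ℓ)) (#returnsUpTo ℓ) (∑ (words (suc ℓ)) leaf) ⟩
      #inner (suc ℓ) + ∑ (words (suc ℓ)) leaf + #returnsUpTo ℓ
        ≤⟨ +-monoˡ-≤ (#returnsUpTo ℓ) (∑-inner+leaf-suc ℓ |w|≤ℓ) ⟩
      #innerExt ℓ + #returnsUpTo ℓ ∎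
      where
      open ≤-Reasoning
      shuffle : ∀ a b c → a + (b + c) ≡ a + c + b
      shuffle = solve-∀

    #covered-suc : ∀ ℓ → #covered (suc ℓ) ≡ ∑[ x ← words ℓ ] (innerSuffixes x * #Eˡ x)
    #covered-suc ℓ = trans (∑-words-∷ ℓ innerProperSuffixes) (∑-words-cong ℓ λ x _ →
      trans (∑-cong letters (λ a _ → *-comm (χ (a ∷ x)) (innerSuffixes x)))
            (∑-distribˡ-* (letters {k}) (innerSuffixes x) _))

    #coveredExt-suc : ∀ ℓ → #coveredExt (suc ℓ) ≡ ∑[ x ← words ℓ ] (innerSuffixes x * #B x)
    #coveredExt-suc ℓ = trans (∑-words-∷ ℓ _) (∑-words-cong ℓ λ x _ →
      trans (∑-cong letters (λ a _ → drop-χ a x)) (∑-distribˡ-* (letters {k}) (innerSuffixes x) _))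
      where
      drop-χ : ∀ a x → χ (a ∷ x) * innerSuffixes x * #Eʳ (a ∷ x) ≡ innerSuffixes x * #Eʳ (a ∷ x)
      drop-χ a x = begin
        χ (a ∷ x) * innerSuffixes x * #Eʳ (a ∷ x)
          ≡⟨ cong (_* #Eʳ (a ∷ x)) (*-comm (χ (a ∷ x)) (innerSuffixes x)) ⟩
        innerSuffixes x * χ (a ∷ x) * #Eʳ (a ∷ x)
          ≡⟨ *-assoc (innerSuffixes x) (χ (a ∷ x)) (#Eʳ (a ∷ x)) ⟩
        innerSuffixes x * (χ (a ∷ x) * #Eʳ (a ∷ x))
          ≡⟨ cong (innerSuffixes x *_) (χ*#Eʳ (a ∷ x)) ⟩
        innerSuffixes x * #Eʳ (a ∷ x) ∎
        where open ≡-Reasoning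

    ∑-innerSuffixes*#Eʳ : ∀ ℓ → ∑[ x ← words ℓ ] (innerSuffixes x * #Eʳ x) ≡ #innerExt ℓ + #coveredExt ℓ
    ∑-innerSuffixes*#Eʳ ℓ =
      trans (∑-cong (words ℓ) (λ x _ → *-distribʳ-+ (#Eʳ x) (inner x) (innerProperSuffixes x)))
            (∑-distrib-+ (words ℓ) _ _)

    -- With subtraction: Σ (#Eʳ − 1) over the covered factors of length ℓ + 1 is at least the same sum
    -- over the inner nodes and the covered factors of length ℓ.
    excess-suc : ∀ ℓ → ℓ < N →
      #covered (suc ℓ) + (#innerExt ℓ + #coveredExt ℓ) ≤ #coveredExt (suc ℓ) + (#inner ℓ + #covered ℓ)
    excess-suc ℓ ℓ<N = begin
      #covered (suc ℓ) + (#innerExt ℓ + #coveredExt ℓ)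
        ≡⟨ cong₂ _+_ (#covered-suc ℓ) (sym (∑-innerSuffixes*#Eʳ ℓ)) ⟩
      ∑[ x ← words ℓ ] (innerSuffixes x * #Eˡ x) + ∑[ x ← words ℓ ] (innerSuffixes x * #Eʳ x)
        ≡⟨ ∑-distrib-+ (words ℓ) _ _ ⟨
      ∑[ x ← words ℓ ] (innerSuffixes x * #Eˡ x + innerSuffixes x * #Eʳ x)
        ≤⟨ ∑-words-mono-≤ ℓ (λ x |x|≡ℓ → bilateral-weighted x (subst (_< N) (sym |x|≡ℓ) ℓ<N)) ⟩
      ∑[ x ← words ℓ ] (innerSuffixes x * #B x + innerSuffixes x)
        ≡⟨ ∑-distrib-+ (words ℓ) _ _ ⟩
      ∑[ x ← words ℓ ] (innerSuffixes x * #B x) + ∑ (words ℓ) innerSuffixes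
        ≡⟨ cong₂ _+_ (#coveredExt-suc ℓ) (sym (∑-distrib-+ (words ℓ) inner innerProperSuffixes)) ⟨
      #coveredExt (suc ℓ) + (#inner ℓ + #covered ℓ) ∎
      where
      open ≤-Reasoning
      bilateral-weighted : ∀ x → length x < N →
        innerSuffixes x * #Eˡ x + innerSuffixes x * #Eʳ x ≤ innerSuffixes x * #B x + innerSuffixes x
      bilateral-weighted x |x|<N = begin
        innerSuffixes x * #Eˡ x + innerSuffixes x * #Eʳ x ≡⟨ *-distribˡ-+ (innerSuffixes x) (#Eˡ x) (#Eʳ x) ⟨
        innerSuffixes x * (#Eˡ x + #Eʳ x)                 ≤⟨ *-monoʳ-≤ (innerSuffixes x) (bilateral x |x|<N) ⟩
        innerSuffixes x * (#B x + 1)                      ≡⟨ *-distribˡ-+ (innerSuffixes x) (#B x) 1 ⟩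
        innerSuffixes x * #B x + innerSuffixes x * 1      ≡⟨ cong (innerSuffixes x * #B x +_) (*-identityʳ _) ⟩
        innerSuffixes x * #B x + innerSuffixes x          ∎

    -- c, i, r, e stand for #covered, #inner, #returnsUpTo and #coveredExt at one length (primed: at the
    -- next one), and n, n′ for C(N), C(N + 1).
    invariant-step-arith : ∀ c i r e c′ i′ r′ e′ ie →
      c + i + r ≤ e + 1 → c′ + (ie + e) ≤ e′ + (i + c) → i′ + r′ ≤ ie + r → c′ + i′ + r′ ≤ e′ + 1
    invariant-step-arith c i r e c′ i′ r′ e′ ie inv excess trie = +-cancelʳ-≤ e _ _ (begin
      c′ + i′ + r′ + e   ≡⟨ shuffle₁ c′ i′ r′ e ⟩
      c′ + e + (i′ + r′) ≤⟨ +-monoʳ-≤ (c′ + e) trie ⟩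
      c′ + e + (ie + r)  ≡⟨ shuffle₂ c′ e ie r ⟩
      c′ + (ie + e) + r  ≤⟨ +-monoˡ-≤ r excess ⟩
      e′ + (i + c) + r   ≡⟨ shuffle₃ e′ i c r ⟩
      e′ + (c + i + r)   ≤⟨ +-monoʳ-≤ e′ inv ⟩
      e′ + (e + 1)       ≡⟨ shuffle₄ e′ e ⟩
      e′ + 1 + e         ∎)
      where
      open ≤-Reasoning
      shuffle₁ : ∀ a b c d → a + b + c + d ≡ a + d + (b + c)
      shuffle₁ = solve-∀
      shuffle₂ : ∀ a b c d → a + b + (c + d) ≡ a + (c + b) + d
      shuffle₂ = solve-∀
      shuffle₃ : ∀ a b c d → a + (b + c) + d ≡ a + (c + b + d)
      shuffle₃ = solve-∀
      shuffle₄ : ∀ a b → a + (b + 1) ≡ a + 1 + b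
      shuffle₄ = solve-∀

    complexity-arith : ∀ c i r e n n′ m → c + i + r ≤ e + 1 → e + n ≤ n′ + c → suc n′ ≤ n + m → r ≤ m
    complexity-arith c i r e n n′ m inv excess ΔC<m = +-cancelʳ-≤ (c + n) r m (begin
      r + (c + n)   ≡⟨ shuffle₁ r c n ⟩
      c + r + n     ≤⟨ +-monoˡ-≤ n (+-monoˡ-≤ r (m≤m+n c i)) ⟩
      c + i + r + n ≤⟨ +-monoˡ-≤ n inv ⟩
      e + 1 + n     ≡⟨ shuffle₂ e n ⟩
      suc (e + n)   ≤⟨ s≤s excess ⟩
      suc n′ + c    ≤⟨ +-monoˡ-≤ c ΔC<m ⟩
      n + m + c     ≡⟨ shuffle₃ n m c ⟩
      m + (c + n)   ∎)
      where
      open ≤-Reasoning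
      shuffle₁ : ∀ a b c → a + (b + c) ≡ b + a + c
      shuffle₁ = solve-∀
      shuffle₂ : ∀ a b → a + 1 + b ≡ suc (a + b)
      shuffle₂ = solve-∀
      shuffle₃ : ∀ a b c → a + b + c ≡ b + (c + a)
      shuffle₃ = solve-∀

    -- With subtraction: #inner ℓ + #returnsUpTo ℓ ≤ 1 + Σ (#Eʳ − 1) over the covered factors of length ℓ.
    Invariant : ℕ → Set
    Invariant ℓ = #covered ℓ + #inner ℓ + #returnsUpTo ℓ ≤ #coveredExt ℓ + 1

    invariant-|w| : Invariant (length w)
    invariant-|w| = begin
      #covered (length w) + #inner (length w) + #returnsUpTo (length w)
        ≡⟨ cong₂ (λ c r → c + #inner (length w) + r)
             (∑-words-zero (length w) (λ y |y|≡ → innerProperSuffixes-short y (≤-reflexive |y|≡)))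
             #returnsUpTo-|w| ⟩
      #inner (length w) + 0
        ≡⟨ +-identityʳ _ ⟩
      #inner (length w)
        ≤⟨ ∑-words-mono-≤ (length w) inner≤𝟙≡w ⟩
      ∑[ y ← words (length w) ] 𝟙 (y ≟ʷ w)
        ≤⟨ ∑-𝟙≡-≤1 _≟ʷ_ w (words-unique (length w)) ⟩
      1
        ≤⟨ m≤n+m 1 _ ⟩
      #coveredExt (length w) + 1 ∎
      where open ≤-Reasoning

    invariant-suc : ∀ ℓ → length w ≤ ℓ → ℓ < N → Invariant ℓ → Invariant (suc ℓ)
    invariant-suc ℓ |w|≤ℓ ℓ<N inv =
      invariant-step-arith (#covered ℓ) (#inner ℓ) (#returnsUpTo ℓ) (#coveredExt ℓ)
        (#covered (suc ℓ)) (#inner (suc ℓ)) (#returnsUpTo (suc ℓ)) (#coveredExt (suc ℓ)) (#innerExt ℓ)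
        inv (excess-suc ℓ ℓ<N) (inner+returns-suc ℓ |w|≤ℓ)

    invariant-N : Invariant N
    invariant-N =
      subst Invariant (m+[n∸m]≡n |w|≤N) (invariant-from (N ∸ length w) (≤-reflexive (m+[n∸m]≡n |w|≤N)))
      where
      invariant-from : ∀ i → length w + i ≤ N → Invariant (length w + i)
      invariant-from zero    _ = subst Invariant (sym (+-identityʳ (length w))) invariant-|w|
      invariant-from (suc i) |w|+1+i≤N = subst Invariant (sym (+-suc (length w) i))
        (invariant-suc (length w + i) (m≤m+n (length w) i) |w|+i<N (invariant-from i (<⇒≤ |w|+i<N)))
        where
        |w|+i<N : length w + i < N
        |w|+i<N = subst (_≤ N) (+-suc (length w) i) |w|+1+i≤N

    #coveredExt-N : #coveredExt N + ∑ (words N) χ ≤ ∑ (words N) #Eʳ + #covered N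
    #coveredExt-N = begin
      #coveredExt N + ∑ (words N) χ
        ≡⟨ ∑-distrib-+ (words N) _ χ ⟨
      ∑[ y ← words N ] (innerProperSuffixes y * #Eʳ y + χ y)
        ≤⟨ ∑-words-mono-≤ N (λ y |y|≡N →
             m*n+o≤n+m (innerProperSuffixes≤1 y) (χ≤#Eʳ y (≤-reflexive |y|≡N)) (χ≤1 y)) ⟩
      ∑[ y ← words N ] (#Eʳ y + innerProperSuffixes y)
        ≡⟨ ∑-distrib-+ (words N) #Eʳ _ ⟩
      ∑ (words N) #Eʳ + #covered N ∎
      where open ≤-Reasoning

    #returns≤ : ∀ m → (∀ n c c′ → FactorComplexity u n c → FactorComplexity u (suc n) c′ → c′ < c + m) →
      length ds ≤ m
    #returns≤ m ΔC<m = subst (_≤ m) #returnsUpTo-N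
      (complexity-arith (#covered N) (#inner N) (#returnsUpTo N) (#coveredExt N) (∑ (words N) χ) (∑ (words N) #Eʳ) m
        invariant-N #coveredExt-N ΔC-N<m)
      where
      ΔC-N<m : suc (∑ (words N) #Eʳ) ≤ ∑ (words N) χ + m
      ΔC-N<m = subst (λ c′ → c′ < ∑ (words N) χ + m) (∑-words-∷ʳ N χ)
                  (ΔC<m N _ _ (complexity N (n≤1+n N)) (complexity (suc N) ≤-refl))

-- The conclusion is decidable, so it may be proved under a double negation, which decides membership
-- in the language up to any fixed length.
lemma4p4 : {k : ℕ} (u : InfWord k) (m : ℕ) →
    Recurrent u →
    (∀ w → ¬ WeakBispecial u w) →
    (∀ n c c′ → FactorComplexity u n c → FactorComplexity u (suc n) c′ → c′ < c + m) →
    ∀ w → Factor u w →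
    (L : List (FWord k)) → Unique L → All (ReturnWord u w) L → length L ≤ m
lemma4p4 u m _ no-weak-bispecial ΔC<m w _ L L-unique L-returns =
  let ds , ds-distinct , |ds|≡|L| = returnOccurrences L L-unique L-returns
  in decidable-stable (length L ≤? m) λ L≰m →
       ¬¬-decideUpTo (Factor u) (suc (lengthBound ds)) λ factor? →
         L≰m (subst (_≤ m) |ds|≡|L| (Counting.#returns≤ ds ds-distinct factor? no-weak-bispecial m ΔC<m))
  where open ReturnWords u w
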